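{- Let $q$ be an odd prime power with $q \equiv 1 \pmod 4$, and for $i,j,k \in F_q$ let $f(i,j,k) = ij - (k-i-j)^2/4$. For every $i \in F_q^{\ast}$ there exists $j \in F_q^{\ast}$ such that both $f(i,i,j)$ and $f(j,j,i)$ are squares in $F_q$ (possibly zero).
   Context: $F_q$ is the finite field with $q$ elements and $F_q^{\ast}$ its nonzero elements. -}

module Defs where

open import Level using (Level; _⊔_) renaming (suc to lsuc)
open import Algebra.Bundles using (CommutativeRing)
open import Data.Nat using (ℕ; _^_; suc)
open import Data.Nat.Primality using (Prime)
open import Data.Fin using (Fin)
open import Data.Product using (Σ; ∃; _×_)
open import Relation.Nullary using (¬_)
open import Relation.Binary.Definitions using (Decidable)
open import Relation.Binary.PropositionalEquality using (_≡_)

record FiniteField (c ℓ : Level) : Set (lsuc (c ⊔ ℓ)) where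
  field
    commutativeRing : CommutativeRing c ℓ
  open CommutativeRing commutativeRing public
  field
    _≟_      : Decidable _≈_
    0≉1      : ¬ (0# ≈ 1#)
    inverse  : ∀ x → ¬ (x ≈ 0#) → ∃ λ y → x * y ≈ 1#
    card     : ℕ
    enum     : Fin card → Carrier
    enum-inj : ∀ a b → enum a ≈ enum b → a ≡ b
    enum-sur : ∀ x → ∃ λ a → enum a ≈ x

IsPrimePower : ℕ → Set
IsPrimePower q = ∃ λ p → ∃ λ e → Prime p × q ≡ p ^ suc e

module _ {c ℓ} (F : FiniteField c ℓ) where
  open FiniteField F

  IsSquare : Carrier → Set (c ⊔ ℓ)
  IsSquare x = ∃ λ y → y * y ≈ x

  four : Carrier
  four = 1# + 1# + 1# + 1#

  -- f(i,j,k) = ij - (k-i-j)^2/4, where quarter is the element 1/4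
  f : (quarter : Carrier) → Carrier → Carrier → Carrier → Carrier
  f quarter i j k = i * j - ((k - i - j) * (k - i - j)) * quarter

{-# OPTIONS --safe #-}
-- Since f(i,i,j) = j(4i − j)/4, taking j = t·i makes f(i,i,j) = t(4 − t)·(i/2)² and
-- f(j,j,i) = (4t − 1)·(i/2)², so it suffices to find t ≠ 0 with t(4 − t) and 4t − 1 both
-- squares.  If 3 is a square take t = 1, if −5 is a square take t = −1; otherwise take t = −6:
-- then t(4 − t) = 3·(−5)·2² is a product of two non-squares, hence a square, and
-- 4t − 1 = −1·5² is a square because −1 is one when q ≡ 1 (mod 4).
--
-- Both facts about squares are proved by counting.  If a, b and ab were all non-squares, the
-- classes x², a·x², b·x² (x ≠ 0) would be disjoint, and since x² determines x up to sign the
-- map (k, x) ↦ (sign of x, c_k·x²), c = (1, a, b), would inject three copies of F into two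
-- copies plus three points for x = 0, which is impossible once q > 3.  If −1 were not a
-- square, negation would swap the nonzero squares with the non-squares, so there would be
-- (q − 1)/2 nonzero squares; but inversion pairs off the nonzero squares other than 1 (its
-- fixed points are ±1), so (q − 1)/2 would be odd.
module Submission where

open import Defs
open import Level using (Level; _⊔_)
open import Data.Empty using (⊥-elim)
open import Data.Unit using (tt)
open import Data.Maybe using (Maybe; just; nothing)
open import Data.Product using (_×_; _,_; proj₁; proj₂; ∃)
import Data.Product.Properties as Productₚ
open import Data.Sum as Sum using (_⊎_; inj₁; inj₂)
import Data.Sum.Properties as Sumₚ
open import Data.Sum.Function.Propositional using (_⊎-↔_)
open import Data.Nat using (ℕ; zero; suc; _%_)
import Data.Nat as ℕ
import Data.Nat.DivMod as ℕ
import Data.Nat.Properties as ℕₚ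
open import Data.Nat.Divisibility using (_∣_; divides)
open import Data.Nat.Solver using (module +-*-Solver)
open import Data.Fin as Fin using (Fin; zero; suc; _<_)
open import Data.Fin.Patterns using (0F; 1F; 2F)
import Data.Fin.Properties as Finₚ
open import Data.Fin.Properties using (_<?_; <-asym; <-cmp; suc-injective; *↔×; +↔⊎; injective⇒≤)
open import Data.Fin.Permutation using (Permutation′; permutation; _⟨$⟩ʳ_)
open import Function using (Injection; _↣_; mk↣; _∘_; id)
open import Function.Construct.Composition using (_↣-∘_; _↔-∘_)
open import Function.Properties.Inverse using (↔-refl; ↔-sym; ↔⇒↣)
open import Relation.Binary.Definitions using (tri<; tri≈; tri>)
open import Relation.Binary.PropositionalEquality as ≡ using (_≡_; _≢_; cong; cong₂)
open import Relation.Nullary using (Dec; yes; no; ¬_; ¬?; _⊎-dec_; _×-dec_; contradiction)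
open import Relation.Nullary.Decidable as Dec using (toSum)
open import Relation.Unary using (Pred; Decidable; _≐_; _⊆_; _∪_; _∩_; _⊥_)
open import Relation.Unary.Properties using (U?; _∪?_; _∩?_)
open import Algebra.Bundles using (CommutativeRing)
open import Algebra.Properties.CommutativeMonoid.Sum ℕₚ.+-0-commutativeMonoid
  using (sum; ∑-distrib-+; sum-permute; sum-cong-≗)
import Algebra.Solver.Ring
import Algebra.Solver.Ring.AlmostCommutativeRing as AlmostCommutativeRing

module IntegerRingSolver {c ℓ} (R : CommutativeRing c ℓ) where
  open import Data.Integer as ℤ using (ℤ; +_; -[1+_]; _⊖_)
  import Data.Integer.Properties as ℤₚ
  open CommutativeRing R
  open import Algebra.Properties.Semiring.Mult.TCOptimised semiring
    using (×-homo-+; ×1-homo-*; 1+×) renaming (_×_ to _×ℕ_)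
  open import Algebra.Properties.Ring ring
    using (-‿involutive; -0#≈0#; -‿distribˡ-*; -‿distribʳ-*; -‿+-comm)
  open import Relation.Binary.Reasoning.Setoid setoid

  fromℤ : ℤ → Carrier
  fromℤ (+ n)    = n ×ℕ 1#
  fromℤ -[1+ n ] = - (suc n ×ℕ 1#)

  fromℤ-neg : ∀ z → fromℤ (ℤ.- z) ≈ - fromℤ z
  fromℤ-neg (+ zero)  = sym -0#≈0#
  fromℤ-neg (+ suc n) = refl
  fromℤ-neg -[1+ n ]  = sym (-‿involutive _)

  [x+y]-[x+z]≈y-z : ∀ x y z → (x + y) - (x + z) ≈ y - z
  [x+y]-[x+z]≈y-z x y z = begin
    (x + y) + - (x + z)   ≈⟨ +-congˡ (sym (-‿+-comm x z)) ⟩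
    (x + y) + (- x + - z) ≈⟨ +-assoc x y _ ⟩
    x + (y + (- x + - z)) ≈⟨ +-congˡ (sym (+-assoc y (- x) (- z))) ⟩
    x + ((y + - x) + - z) ≈⟨ +-congˡ (+-congʳ (+-comm y (- x))) ⟩
    x + ((- x + y) + - z) ≈⟨ +-congˡ (+-assoc (- x) y (- z)) ⟩
    x + (- x + (y - z))   ≈⟨ sym (+-assoc x (- x) _) ⟩
    (x + - x) + (y - z)   ≈⟨ +-congʳ (-‿inverseʳ x) ⟩
    0# + (y - z)          ≈⟨ +-identityˡ _ ⟩
    y - z                 ∎

  fromℤ-⊖ : ∀ m n → fromℤ (m ⊖ n) ≈ m ×ℕ 1# - n ×ℕ 1#
  fromℤ-⊖ m       zero    = sym (trans (+-congˡ -0#≈0#) (+-identityʳ _))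
  fromℤ-⊖ zero    (suc n) = sym (+-identityˡ _)
  fromℤ-⊖ (suc m) (suc n) = begin
    fromℤ (suc m ⊖ suc n)                ≡⟨ cong fromℤ (ℤₚ.[1+m]⊖[1+n]≡m⊖n m n) ⟩
    fromℤ (m ⊖ n)                        ≈⟨ fromℤ-⊖ m n ⟩
    m ×ℕ 1# - n ×ℕ 1#                    ≈⟨ [x+y]-[x+z]≈y-z 1# _ _ ⟨
    (1# + m ×ℕ 1#) - (1# + n ×ℕ 1#)      ≈⟨ +-cong (1+× m 1#) (-‿cong (1+× n 1#)) ⟨
    suc m ×ℕ 1# - suc n ×ℕ 1#            ∎

  fromℤ-+ : ∀ x y → fromℤ (x ℤ.+ y) ≈ fromℤ x + fromℤ y
  fromℤ-+ (+ m)    (+ n)    = ×-homo-+ 1# m n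
  fromℤ-+ (+ m)    -[1+ n ] = fromℤ-⊖ m (suc n)
  fromℤ-+ -[1+ m ] (+ n)    = trans (fromℤ-⊖ n (suc m)) (+-comm _ _)
  fromℤ-+ -[1+ m ] -[1+ n ] = begin
    - (suc (suc (m ℕ.+ n)) ×ℕ 1#)      ≡⟨ cong (λ k → - (suc k ×ℕ 1#)) (ℕₚ.+-suc m n) ⟨
    - ((suc m ℕ.+ suc n) ×ℕ 1#)        ≈⟨ -‿cong (×-homo-+ 1# (suc m) (suc n)) ⟩
    - (suc m ×ℕ 1# + suc n ×ℕ 1#)      ≈⟨ -‿+-comm _ _ ⟨
    - (suc m ×ℕ 1#) + - (suc n ×ℕ 1#)  ∎

  fromℤ-*-pos : ∀ m n → fromℤ (+ m ℤ.* + n) ≈ fromℤ (+ m) * fromℤ (+ n)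
  fromℤ-*-pos m n = trans (reflexive (cong fromℤ (≡.sym (ℤₚ.pos-* m n)))) (×1-homo-* m n)

  fromℤ-*-posˡ : ∀ m y → fromℤ (+ m ℤ.* y) ≈ fromℤ (+ m) * fromℤ y
  fromℤ-*-posˡ m (+ n)    = fromℤ-*-pos m n
  fromℤ-*-posˡ m -[1+ n ] = begin
    fromℤ (+ m ℤ.* ℤ.- + suc n)        ≡⟨ cong fromℤ (ℤₚ.neg-distribʳ-* (+ m) (+ suc n)) ⟨
    fromℤ (ℤ.- (+ m ℤ.* + suc n))      ≈⟨ fromℤ-neg (+ m ℤ.* + suc n) ⟩
    - fromℤ (+ m ℤ.* + suc n)          ≈⟨ -‿cong (fromℤ-*-pos m (suc n)) ⟩
    - (fromℤ (+ m) * fromℤ (+ suc n))  ≈⟨ -‿distribʳ-* _ _ ⟩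
    fromℤ (+ m) * - fromℤ (+ suc n)    ∎

  fromℤ-* : ∀ x y → fromℤ (x ℤ.* y) ≈ fromℤ x * fromℤ y
  fromℤ-* (+ m)    y = fromℤ-*-posˡ m y
  fromℤ-* -[1+ m ] y = begin
    fromℤ (ℤ.- (+ suc m) ℤ.* y)        ≡⟨ cong fromℤ (ℤₚ.neg-distribˡ-* (+ suc m) y) ⟨
    fromℤ (ℤ.- (+ suc m ℤ.* y))        ≈⟨ fromℤ-neg (+ suc m ℤ.* y) ⟩
    - fromℤ (+ suc m ℤ.* y)            ≈⟨ -‿cong (fromℤ-*-posˡ (suc m) y) ⟩
    - (fromℤ (+ suc m) * fromℤ y)      ≈⟨ -‿distribˡ-* _ _ ⟩
    - fromℤ (+ suc m) * fromℤ y        ∎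

  R′ = AlmostCommutativeRing.fromCommutativeRing R

  fromℤ-homomorphism : ℤ.+-*-rawRing AlmostCommutativeRing.-Raw-AlmostCommutative⟶ R′
  fromℤ-homomorphism = record
    { ⟦_⟧    = fromℤ
    ; +-homo = fromℤ-+
    ; *-homo = fromℤ-*
    ; -‿homo = fromℤ-neg
    ; 0-homo = refl
    ; 1-homo = refl
    }

  fromℤ-≟ : ∀ x y → Maybe (fromℤ x ≈ fromℤ y)
  fromℤ-≟ x y with x ℤ.≟ y
  ... | yes ≡.refl = just refl
  ... | no _       = nothing

  open Algebra.Solver.Ring ℤ.+-*-rawRing R′ fromℤ-homomorphism fromℤ-≟ public

module Counting where
  open Finₚ using (_≟_)
  open import Data.Nat using (_+_; _*_; _≤_)
  open ≡.≡-Reasoning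

  private
    variable
      a b m n : ℕ
      p q : Level
      P : Pred (Fin n) p
      Q : Pred (Fin n) q

  indicator : ∀ {p} {A : Set p} → Dec A → ℕ
  indicator (yes _) = 1
  indicator (no _)  = 0

  count : Decidable P → ℕ
  count P? = sum λ i → indicator (P? i)

  count-cong : (P? : Decidable P) (Q? : Decidable Q) → P ≐ Q → count P? ≡ count Q?
  count-cong {P = P} {Q = Q} P? Q? (P⊆Q , Q⊆P) = sum-cong-≗ λ i → same (P? i) (Q? i)
    where
    same : ∀ {i} (p : Dec (P i)) (q : Dec (Q i)) → indicator p ≡ indicator q
    same (yes _)  (yes _)  = ≡.refl
    same (no _)   (no _)   = ≡.refl
    same (yes p)  (no ¬q)  = ⊥-elim (¬q (P⊆Q p))
    same (no ¬p)  (yes q)  = ⊥-elim (¬p (Q⊆P q))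

  count-∪ : (P? : Decidable P) (Q? : Decidable Q) → P ⊥ Q → count (P? ∪? Q?) ≡ count P? + count Q?
  count-∪ {P = P} {Q = Q} P? Q? disjoint =
    ≡.trans (sum-cong-≗ λ i → split (P? i) (Q? i)) (∑-distrib-+ (indicator ∘ P?) (indicator ∘ Q?))
    where
    split : ∀ {i} (p : Dec (P i)) (q : Dec (Q i)) → indicator (p ⊎-dec q) ≡ indicator p + indicator q
    split (yes p) (yes q) = ⊥-elim (disjoint (p , q))
    split (yes _) (no _)  = ≡.refl
    split (no _)  (yes _) = ≡.refl
    split (no _)  (no _)  = ≡.refl

  count-permute : (P? : Decidable P) (π : Permutation′ n) → count (λ i → P? (π ⟨$⟩ʳ i)) ≡ count P?
  count-permute P? π = ≡.sym (sum-permute _ π)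

  count-U : count (U? {A = Fin n}) ≡ n
  count-U {zero}  = ≡.refl
  count-U {suc n} = cong suc (count-U {n})

  count-∅ : (P? : Decidable P) → (∀ i → ¬ P i) → count P? ≡ 0
  count-∅ {zero}  P? ¬P = ≡.refl
  count-∅ {suc n} P? ¬P with P? zero
  ... | yes p = ⊥-elim (¬P zero p)
  ... | no _  = count-∅ (P? ∘ suc) (¬P ∘ suc)

  count-singleton : (k : Fin n) → count (_≟ k) ≡ 1
  count-singleton {suc n} zero    = cong suc (count-∅ (λ (i : Fin n) → suc i ≟ zero) λ i ())
  count-singleton {suc n} (suc k) =
    ≡.trans (count-cong (λ i → suc i ≟ suc k) (_≟ k) (suc-injective , cong suc)) (count-singleton k)

  count-involution : (P? : Decidable P) (ρ : Fin n → Fin n) → (∀ i → ρ (ρ i) ≡ i) →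
                     (∀ {i} → P i → P (ρ i)) → (∀ {i} → P i → ρ i ≢ i) → 2 ∣ count P?
  count-involution {P = P} P? ρ ρ-involutive ρ-preserves ρ-moves = divides (count below?) (begin
    count P?
      ≡⟨ count-cong P? (below? ∪? above?) (split , join) ⟩
    count (below? ∪? above?)
      ≡⟨ count-∪ below? above? (λ ((_ , i<ρi) , (_ , ρi<i)) → <-asym i<ρi ρi<i) ⟩
    count below? + count above?
      ≡⟨ cong (count below? +_) (count-cong above? (below? ∘ ρ) (above→below , below→above)) ⟩
    count below? + count (below? ∘ ρ)
      ≡⟨ cong (count below? +_) (count-permute below? (permutation ρ ρ ρ-involutive ρ-involutive)) ⟩
    count below? + count below?
      ≡⟨ cong (count below? +_) (ℕₚ.+-identityʳ _) ⟨
    2 * count below?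
      ≡⟨ ℕₚ.*-comm 2 (count below?) ⟩
    count below? * 2 ∎)
    where
    below? : Decidable (P ∩ λ i → i < ρ i)
    below? = P? ∩? λ i → i <? ρ i
    above? : Decidable (P ∩ λ i → ρ i < i)
    above? = P? ∩? λ i → ρ i <? i
    split : P ⊆ (P ∩ λ i → i < ρ i) ∪ (P ∩ λ i → ρ i < i)
    split {i} p with <-cmp i (ρ i)
    ... | tri< i<ρi _ _ = inj₁ (p , i<ρi)
    ... | tri≈ _ i≡ρi _ = ⊥-elim (ρ-moves p (≡.sym i≡ρi))
    ... | tri> _ _ ρi<i = inj₂ (p , ρi<i)
    join : (P ∩ λ i → i < ρ i) ∪ (P ∩ λ i → ρ i < i) ⊆ P
    join (inj₁ (p , _)) = p
    join (inj₂ (p , _)) = p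
    above→below : (P ∩ λ i → ρ i < i) ⊆ λ i → P (ρ i) × ρ i < ρ (ρ i)
    above→below {i} (p , ρi<i) = ρ-preserves p , ≡.subst (ρ i <_) (≡.sym (ρ-involutive i)) ρi<i
    below→above : (λ i → P (ρ i) × ρ i < ρ (ρ i)) ⊆ (P ∩ λ i → ρ i < i)
    below→above {i} (p , ρi<ρρi) = ≡.subst P (ρ-involutive i) (ρ-preserves p) , ≡.subst (ρ i <_) (ρ-involutive i) ρi<ρρi

  ≤-flag : Fin n → Fin n → Fin 2
  ≤-flag i j with i Finₚ.≤? j
  ... | yes _ = 0F
  ... | no _  = 1F

  ≤-flag-symmetric⇒≡ : {i j : Fin n} → ≤-flag i j ≡ ≤-flag j i → i ≡ j
  ≤-flag-symmetric⇒≡ {i = i} {j} flags with i Finₚ.≤? j | j Finₚ.≤? i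
  ... | yes i≤j | yes j≤i = Finₚ.≤-antisym i≤j j≤i
  ... | no i≰j  | no j≰i  = contradiction (ℕₚ.≰⇒> i≰j) (ℕₚ.<⇒≯ (ℕₚ.≰⇒> j≰i))
  ... | yes _   | no _    = contradiction flags λ ()
  ... | no _    | yes _   = contradiction flags λ ()

  pigeonhole : (Fin a × Fin n) ↣ (Fin b × Fin n ⊎ Fin m) → a * n ≤ b * n + m
  pigeonhole g = injective⇒≤ (Injection.injective (↔⇒↣ (↔-sym fin) ↣-∘ (g ↣-∘ ↔⇒↣ *↔×)))
    where fin = (*↔× ⊎-↔ ↔-refl) ↔-∘ +↔⊎

module FiniteFieldProperties {c ℓ} (F : FiniteField c ℓ) where
  open FiniteField F
  open IntegerRingSolver commutativeRing
  open import Data.Integer using (+_)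
  open import Algebra.Properties.Ring ring
    using (-‿involutive; -‿injective; -0#≈0#; x∙y⁻¹≈ε⇒x≈y; +-inverseˡ-unique)
  open import Algebra.Definitions _≈_ using (Congruent₁; Involutive)
  open import Relation.Binary.Reasoning.Setoid setoid
  open Counting

  private
    variable
      a b x y : Carrier

  index : Carrier → Fin card
  index x = proj₁ (enum-sur x)

  enum-index : ∀ x → enum (index x) ≈ x
  enum-index x = proj₂ (enum-sur x)

  index-cong : x ≈ y → index x ≡ index y
  index-cong {x} {y} x≈y = enum-inj _ _ (trans (enum-index x) (trans x≈y (sym (enum-index y))))

  index-injective : index x ≡ index y → x ≈ y
  index-injective {x} {y} eq = trans (sym (enum-index x)) (trans (reflexive (cong enum eq)) (enum-index y))

  index-enum : ∀ i → index (enum i) ≡ i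
  index-enum i = enum-inj _ _ (enum-index (enum i))

  onIndices : (Carrier → Carrier) → Fin card → Fin card
  onIndices φ i = index (φ (enum i))

  onIndices-involutive : ∀ {φ} → Congruent₁ φ → Involutive φ → ∀ i → onIndices φ (onIndices φ i) ≡ i
  onIndices-involutive {φ} φ-cong φ-involutive i =
    enum-inj _ _ (trans (enum-index _) (trans (φ-cong (enum-index _)) (φ-involutive (enum i))))

  count-enum≈ : ∀ a → count (λ i → enum i ≟ a) ≡ 1
  count-enum≈ a = ≡.trans (count-cong _ (Finₚ._≟ index a) (to , from)) (count-singleton (index a))
    where
    to : ∀ {i} → enum i ≈ a → i ≡ index a
    to {i} eq = ≡.trans (≡.sym (index-enum i)) (index-cong eq)
    from : ∀ {i} → i ≡ index a → enum i ≈ a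
    from ≡.refl = enum-index a

  -‿nonzero : x ≉ 0# → - x ≉ 0#
  -‿nonzero x≉0 -x≈0 = x≉0 (-‿injective (trans -x≈0 (sym -0#≈0#)))

  -- With 0⁻¹ = 0 inversion is a total involution, so it permutes the indices.
  _⁻¹ : Carrier → Carrier
  x ⁻¹ with x ≟ 0#
  ... | yes _   = 0#
  ... | no x≉0 = proj₁ (inverse x x≉0)

  ⁻¹-inverseʳ : x ≉ 0# → x * x ⁻¹ ≈ 1#
  ⁻¹-inverseʳ {x} x≉0 with x ≟ 0#
  ... | yes x≈0 = contradiction x≈0 x≉0
  ... | no x≉0  = proj₂ (inverse x x≉0)

  ⁻¹-zero : x ≈ 0# → x ⁻¹ ≈ 0#
  ⁻¹-zero {x} x≈0 with x ≟ 0#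
  ... | yes _   = refl
  ... | no x≉0 = contradiction x≈0 x≉0

  ⁻¹-nonzero : x ≉ 0# → x ⁻¹ ≉ 0#
  ⁻¹-nonzero {x} x≉0 x⁻¹≈0 = 0≉1 (begin
    0#         ≈⟨ zeroʳ x ⟨
    x * 0#     ≈⟨ *-congˡ x⁻¹≈0 ⟨
    x * x ⁻¹   ≈⟨ ⁻¹-inverseʳ x≉0 ⟩
    1#         ∎)

  *-cancelˡ : a ≉ 0# → a * x ≈ a * y → x ≈ y
  *-cancelˡ {a} {x} {y} a≉0 eq = begin
    x                ≈⟨ scale x ⟨
    a ⁻¹ * (a * x)   ≈⟨ *-congˡ eq ⟩
    a ⁻¹ * (a * y)   ≈⟨ scale y ⟩
    y                ∎
    where
    scale : ∀ z → a ⁻¹ * (a * z) ≈ z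
    scale z = begin
      a ⁻¹ * (a * z)  ≈⟨ solve 3 (λ a b z → b :* (a :* z) := (a :* b) :* z) refl a (a ⁻¹) z ⟩
      (a * a ⁻¹) * z  ≈⟨ *-congʳ (⁻¹-inverseʳ a≉0) ⟩
      1# * z          ≈⟨ *-identityˡ z ⟩
      z               ∎

  x*y≈0⇒x≈0⊎y≈0 : x * y ≈ 0# → x ≈ 0# ⊎ y ≈ 0#
  x*y≈0⇒x≈0⊎y≈0 {x} {y} x*y≈0 with x ≟ 0#
  ... | yes x≈0 = inj₁ x≈0
  ... | no x≉0  = inj₂ (*-cancelˡ x≉0 (trans x*y≈0 (sym (zeroʳ x))))

  *-nonzero : x ≉ 0# → y ≉ 0# → x * y ≉ 0#
  *-nonzero x≉0 y≉0 = Sum.[ x≉0 , y≉0 ]′ ∘ x*y≈0⇒x≈0⊎y≈0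

  x*x≈y*y⇒x≈±y : x * x ≈ y * y → x ≈ y ⊎ x ≈ - y
  x*x≈y*y⇒x≈±y {x} {y} x²≈y² = Sum.map (x∙y⁻¹≈ε⇒x≈y x y) (+-inverseˡ-unique x y)
    (x*y≈0⇒x≈0⊎y≈0 (begin
      (x - y) * (x + y)  ≈⟨ solve 2 (λ x y → (x :- y) :* (x :+ y) := x :* x :- y :* y) refl x y ⟩
      x * x - y * y      ≈⟨ +-congʳ x²≈y² ⟩
      y * y - y * y      ≈⟨ -‿inverseʳ (y * y) ⟩
      0#                 ∎))

  ⁻¹-cong : Congruent₁ _⁻¹
  ⁻¹-cong {x} {y} x≈y = Sum.[ zero-case , nonzero-case ]′ (toSum (x ≟ 0#))
    where
    zero-case : x ≈ 0# → x ⁻¹ ≈ y ⁻¹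
    zero-case x≈0 = trans (⁻¹-zero x≈0) (sym (⁻¹-zero (trans (sym x≈y) x≈0)))
    nonzero-case : x ≉ 0# → x ⁻¹ ≈ y ⁻¹
    nonzero-case x≉0 = *-cancelˡ x≉0 (begin
      x * x ⁻¹   ≈⟨ ⁻¹-inverseʳ x≉0 ⟩
      1#         ≈⟨ ⁻¹-inverseʳ (x≉0 ∘ trans x≈y) ⟨
      y * y ⁻¹   ≈⟨ *-congʳ x≈y ⟨
      x * y ⁻¹   ∎)

  ⁻¹-involutive : Involutive _⁻¹
  ⁻¹-involutive x = Sum.[ zero-case , nonzero-case ]′ (toSum (x ≟ 0#))
    where
    zero-case : x ≈ 0# → x ⁻¹ ⁻¹ ≈ x
    zero-case x≈0 = trans (⁻¹-zero (⁻¹-zero x≈0)) (sym x≈0)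
    nonzero-case : x ≉ 0# → x ⁻¹ ⁻¹ ≈ x
    nonzero-case x≉0 = *-cancelˡ (⁻¹-nonzero x≉0) (begin
      x ⁻¹ * x ⁻¹ ⁻¹  ≈⟨ ⁻¹-inverseʳ (⁻¹-nonzero x≉0) ⟩
      1#              ≈⟨ ⁻¹-inverseʳ x≉0 ⟨
      x * x ⁻¹        ≈⟨ *-comm x (x ⁻¹) ⟩
      x ⁻¹ * x        ∎)

  isSquare? : Decidable (IsSquare F)
  isSquare? x = Dec.map′ (λ (i , i²≈x) → enum i , i²≈x)
                         (λ (y , y²≈x) → index y , trans (*-cong (enum-index y) (enum-index y)) y²≈x)
                         (Finₚ.any? λ i → (enum i * enum i) ≟ x)

  IsSquare-resp-≈ : x ≈ y → IsSquare F x → IsSquare F y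
  IsSquare-resp-≈ x≈y (s , s²≈x) = s , trans s²≈x x≈y

  IsSquare-* : IsSquare F x → IsSquare F y → IsSquare F (x * y)
  IsSquare-* {x} {y} (s , s²≈x) (t , t²≈y) = s * t , (begin
    (s * t) * (s * t)  ≈⟨ solve 2 (λ s t → (s :* t) :* (s :* t) := (s :* s) :* (t :* t)) refl s t ⟩
    (s * s) * (t * t)  ≈⟨ *-cong s²≈x t²≈y ⟩
    x * y              ∎)

  IsSquare-cancelʳ : y ≉ 0# → IsSquare F (x * y) → IsSquare F y → IsSquare F x
  IsSquare-cancelʳ {y} {x} y≉0 (s , s²≈xy) (t , t²≈y) = s * t ⁻¹ , (begin
    (s * t ⁻¹) * (s * t ⁻¹)          ≈⟨ solve 2 (λ s u → (s :* u) :* (s :* u) := (s :* s) :* (u :* u)) refl s (t ⁻¹) ⟩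
    (s * s) * (t ⁻¹ * t ⁻¹)          ≈⟨ *-congʳ (trans s²≈xy (*-congˡ (sym t²≈y))) ⟩
    (x * (t * t)) * (t ⁻¹ * t ⁻¹)    ≈⟨ solve 3 (λ x t u → (x :* (t :* t)) :* (u :* u) := x :* ((t :* u) :* (t :* u)))
                                               refl x t (t ⁻¹) ⟩
    x * ((t * t ⁻¹) * (t * t ⁻¹))    ≈⟨ *-congˡ (*-cong tt⁻¹≈1 tt⁻¹≈1) ⟩
    x * (1# * 1#)                    ≈⟨ solve 1 (λ x → x :* (con (+ 1) :* con (+ 1)) := x) refl x ⟩
    x                                ∎)
    where
    tt⁻¹≈1 : t * t ⁻¹ ≈ 1#
    tt⁻¹≈1 = ⁻¹-inverseʳ λ t≈0 → y≉0 (trans (sym t²≈y) (trans (*-congʳ t≈0) (zeroˡ t)))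

  nonsquare⇒nonzero : ¬ IsSquare F x → x ≉ 0#
  nonsquare⇒nonzero ¬□x x≈0 = ¬□x (0# , trans (zeroˡ 0#) (sym x≈0))

  sign : Carrier → Fin 2
  sign x = ≤-flag (index x) (index (- x))

  sign-injective : x ≈ - y → sign x ≡ sign y → x ≈ y
  sign-injective {x} {y} x≈-y signs = index-injective (≤-flag-symmetric⇒≡ flags)
    where
    flags : ≤-flag (index x) (index y) ≡ ≤-flag (index y) (index x)
    flags = ≡.subst₂ (λ u v → ≤-flag (index x) u ≡ ≤-flag (index y) v)
              (index-cong (trans (-‿cong x≈-y) (-‿involutive y))) (index-cong (sym x≈-y)) signs

  module ThreeSquareClasses (¬□a : ¬ IsSquare F a) (¬□b : ¬ IsSquare F b) (¬□ab : ¬ IsSquare F (a * b)) where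
    class : Fin 3 → Carrier
    class 0F = 1#
    class 1F = a
    class 2F = b

    class-nonzero : ∀ k → class k ≉ 0#
    class-nonzero 0F = 0≉1 ∘ sym
    class-nonzero 1F = nonsquare⇒nonzero ¬□a
    class-nonzero 2F = nonsquare⇒nonzero ¬□b

    class-*-nonsquare : ∀ k l → k ≢ l → ¬ IsSquare F (class k * class l)
    class-*-nonsquare 0F 0F 0≢0 = contradiction ≡.refl 0≢0
    class-*-nonsquare 0F 1F _   = ¬□a ∘ IsSquare-resp-≈ (*-identityˡ a)
    class-*-nonsquare 0F 2F _   = ¬□b ∘ IsSquare-resp-≈ (*-identityˡ b)
    class-*-nonsquare 1F 0F _   = ¬□a ∘ IsSquare-resp-≈ (*-identityʳ a)
    class-*-nonsquare 1F 1F 1≢1 = contradiction ≡.refl 1≢1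
    class-*-nonsquare 1F 2F _   = ¬□ab
    class-*-nonsquare 2F 0F _   = ¬□b ∘ IsSquare-resp-≈ (*-identityʳ b)
    class-*-nonsquare 2F 1F _   = ¬□ab ∘ IsSquare-resp-≈ (*-comm b a)
    class-*-nonsquare 2F 2F 2≢2 = contradiction ≡.refl 2≢2

    class-injective : ∀ k l → y ≉ 0# → class k * (x * x) ≈ class l * (y * y) → k ≡ l
    class-injective {y} {x} k l y≉0 eq with k Finₚ.≟ l
    ... | yes k≡l = k≡l
    ... | no k≢l  = contradiction
          (IsSquare-cancelʳ (*-nonzero y≉0 y≉0) (class k * x , square) (y , refl))
          (class-*-nonsquare k l k≢l)
      where
      square : (class k * x) * (class k * x) ≈ (class k * class l) * (y * y)
      square = begin
        (class k * x) * (class k * x)       ≈⟨ solve 2 (λ c x → (c :* x) :* (c :* x) := c :* (c :* (x :* x))) refl (class k) x ⟩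
        class k * (class k * (x * x))       ≈⟨ *-congˡ eq ⟩
        class k * (class l * (y * y))       ≈⟨ *-assoc (class k) (class l) (y * y) ⟨
        (class k * class l) * (y * y)       ∎

    encode : Fin 3 → Carrier → Fin 2 × Fin card
    encode k x = sign x , index (class k * (x * x))

    encode-injective : ∀ k l → y ≉ 0# → encode k x ≡ encode l y → k ≡ l × x ≈ y
    encode-injective {y} {x} k l y≉0 codes
      with class-injective k l y≉0 (index-injective (Productₚ.,-injectiveʳ codes))
    ... | ≡.refl = ≡.refl , Sum.[ id , same-sign ]′ (x*x≈y*y⇒x≈±y squares)
      where
      squares : x * x ≈ y * y
      squares = *-cancelˡ (class-nonzero k) (index-injective (Productₚ.,-injectiveʳ codes))
      same-sign : x ≈ - y → x ≈ y
      same-sign x≈-y = sign-injective x≈-y (Productₚ.,-injectiveˡ codes)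

    code : Fin 3 × Fin card → Fin 2 × Fin card ⊎ Fin 3
    code (k , i) with enum i ≟ 0#
    ... | yes _ = inj₂ k
    ... | no _  = inj₁ (encode k (enum i))

    code-injective : ∀ {u v} → code u ≡ code v → u ≡ v
    code-injective {k , i} {l , j} codes with enum i ≟ 0# | enum j ≟ 0#
    ... | yes i≈0 | yes j≈0 = cong₂ _,_ (Sumₚ.inj₂-injective codes) (enum-inj i j (trans i≈0 (sym j≈0)))
    ... | no _    | no j≉0  = let k≡l , i≈j = encode-injective k l j≉0 (Sumₚ.inj₁-injective codes)
                              in cong₂ _,_ k≡l (enum-inj i j i≈j)

  IsSquare-nonsquare*nonsquare : 3 ℕ.< card → ¬ IsSquare F a → ¬ IsSquare F b → IsSquare F (a * b)
  IsSquare-nonsquare*nonsquare {a} {b} 3<card ¬□a ¬□b with isSquare? (a * b)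
  ... | yes □ab = □ab
  ... | no ¬□ab = contradiction card≤3 (ℕₚ.<⇒≱ 3<card)
    where
    open ThreeSquareClasses ¬□a ¬□b ¬□ab
    -- pigeonhole gives 3 * card ≤ 2 * card + 3, and 3 * card reduces to card + 2 * card.
    card≤3 : card ℕ.≤ 3
    card≤3 = ℕₚ.+-cancelʳ-≤ (2 ℕ.* card) card 3
               (≡.subst (card ℕ.+ 2 ℕ.* card ℕ.≤_) (ℕₚ.+-comm (2 ℕ.* card) 3) (pigeonhole (mk↣ code-injective)))

  2≤card : 2 ℕ.≤ card
  2≤card = Finₚ.injective⇒≤ {f = index ∘ bit} bit-injective
    where
    bit : Fin 2 → Carrier
    bit 0F = 0#
    bit 1F = 1#
    bit-injective : ∀ {i j} → index (bit i) ≡ index (bit j) → i ≡ j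
    bit-injective {0F} {0F} _  = ≡.refl
    bit-injective {0F} {1F} eq = contradiction (index-injective eq) 0≉1
    bit-injective {1F} {0F} eq = contradiction (index-injective eq) (0≉1 ∘ sym)
    bit-injective {1F} {1F} _  = ≡.refl

  card%4≡1⇒3<card : card ℕ.% 4 ≡ 1 → 3 ℕ.< card
  card%4≡1⇒3<card = 3<n card 2≤card
    where
    3<n : ∀ n → 2 ℕ.≤ n → n ℕ.% 4 ≡ 1 → 3 ℕ.< n
    3<n 0 () _
    3<n 1 (ℕ.s≤s ()) _
    3<n 2 _ ()
    3<n 3 _ ()
    3<n (suc (suc (suc (suc n)))) _ _ = ℕ.s≤s (ℕ.s≤s (ℕ.s≤s (ℕ.s≤s ℕ.z≤n)))

  NonzeroSquare : Pred Carrier (c ⊔ ℓ)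
  NonzeroSquare x = x ≉ 0# × IsSquare F x

  nonzeroSquare? : Decidable NonzeroSquare
  nonzeroSquare? x = ¬? (x ≟ 0#) ×-dec isSquare? x

  NonzeroSquare-resp-≈ : x ≈ y → NonzeroSquare x → NonzeroSquare y
  NonzeroSquare-resp-≈ x≈y (x≉0 , □x) = x≉0 ∘ trans x≈y , IsSquare-resp-≈ x≈y □x

  NonzeroSquare-⁻¹ : NonzeroSquare x → NonzeroSquare (x ⁻¹)
  NonzeroSquare-⁻¹ {x} (x≉0 , □x) = ⁻¹-nonzero x≉0 , IsSquare-cancelʳ x≉0 (1# , x⁻¹x≈1) □x
    where x⁻¹x≈1 = trans (*-identityˡ 1#) (trans (sym (⁻¹-inverseʳ x≉0)) (*-comm x (x ⁻¹)))

  x⁻¹≈1⇒x≈1 : x ≉ 0# → x ⁻¹ ≈ 1# → x ≈ 1#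
  x⁻¹≈1⇒x≈1 {x} x≉0 x⁻¹≈1 = begin
    x            ≈⟨ *-identityʳ x ⟨
    x * 1#       ≈⟨ *-congˡ x⁻¹≈1 ⟨
    x * x ⁻¹     ≈⟨ ⁻¹-inverseʳ x≉0 ⟩
    1#           ∎

  x≈x⁻¹⇒x≈±1 : x ≉ 0# → x ≈ x ⁻¹ → x ≈ 1# ⊎ x ≈ - 1#
  x≈x⁻¹⇒x≈±1 {x} x≉0 x≈x⁻¹ = x*x≈y*y⇒x≈±y (begin
    x * x        ≈⟨ *-congˡ x≈x⁻¹ ⟩
    x * x ⁻¹     ≈⟨ ⁻¹-inverseʳ x≉0 ⟩
    1#           ≈⟨ *-identityˡ 1# ⟨
    1# * 1#      ∎)

module SquareRootOfMinusOne {c ℓ} (F : FiniteField c ℓ) where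
  open FiniteField F
  open FiniteFieldProperties F
  open Counting
  open import Algebra.Properties.Ring ring using (-‿involutive; -0#≈0#; -1*x≈-x)
  open ≡.≡-Reasoning

  module WithoutSquareRootOfMinusOne (3<card : 3 ℕ.< card) (¬□-1 : ¬ IsSquare F (- 1#)) where
    neg inv : Fin card → Fin card
    neg = onIndices (-_)
    inv = onIndices _⁻¹

    zero? : Decidable λ i → enum i ≈ 0#
    zero? i = enum i ≟ 0#
    nonzero? : Decidable λ i → enum i ≉ 0#
    nonzero? i = ¬? (zero? i)
    one? : Decidable λ i → enum i ≈ 1#
    one? i = enum i ≟ 1#
    Square Square≢1 : Pred (Fin card) (c ⊔ ℓ)
    Square = NonzeroSquare ∘ enum
    Square≢1 = Square ∩ λ i → enum i ≉ 1#

    square? : Decidable Square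
    square? = nonzeroSquare? ∘ enum
    square≢1? : Decidable Square≢1
    square≢1? = square? ∩? λ i → ¬? (one? i)

    card≡1+2*squares : card ≡ 1 ℕ.+ (count square? ℕ.+ count square?)
    card≡1+2*squares = begin
      card
        ≡⟨ count-U ⟨
      count (U? {A = Fin card})
        ≡⟨ count-cong U? (zero? ∪? nonzero?) ((λ _ → toSum (zero? _)) , (λ _ → tt)) ⟩
      count (zero? ∪? nonzero?)
        ≡⟨ count-∪ zero? nonzero? (λ (x≈0 , x≉0) → x≉0 x≈0) ⟩
      count zero? ℕ.+ count nonzero?
        ≡⟨ cong₂ ℕ._+_ (count-enum≈ 0#) (count-cong nonzero? (square? ∪? square? ∘ neg) (split , join)) ⟩
      1 ℕ.+ count (square? ∪? square? ∘ neg)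
        ≡⟨ cong (1 ℕ.+_) (count-∪ square? (square? ∘ neg) disjoint) ⟩
      1 ℕ.+ (count square? ℕ.+ count (square? ∘ neg))
        ≡⟨ cong (λ k → 1 ℕ.+ (count square? ℕ.+ k)) (count-permute square? (permutation neg neg neg-inv neg-inv)) ⟩
      1 ℕ.+ (count square? ℕ.+ count square?) ∎
      where
      neg-inv = onIndices-involutive -‿cong -‿involutive
      enum-neg : ∀ i → enum (neg i) ≈ - enum i
      enum-neg i = enum-index (- enum i)
      split : (λ i → enum i ≉ 0#) ⊆ Square ∪ (Square ∘ neg)
      split {i} x≉0 with isSquare? (enum i)
      ... | yes □x  = inj₁ (x≉0 , □x)
      ... | no ¬□x = inj₂ (NonzeroSquare-resp-≈ (sym (enum-neg i))
                             ( -‿nonzero x≉0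
                             , IsSquare-resp-≈ (-1*x≈-x (enum i)) (IsSquare-nonsquare*nonsquare 3<card ¬□-1 ¬□x)))
      join : Square ∪ (Square ∘ neg) ⊆ λ i → enum i ≉ 0#
      join (inj₁ (x≉0 , _)) = x≉0
      join {i} (inj₂ (-x≉0 , _)) x≈0 = -x≉0 (trans (enum-neg i) (trans (-‿cong x≈0) -0#≈0#))
      disjoint : Square ⊥ (Square ∘ neg)
      disjoint {i} ((x≉0 , □x) , (_ , □-x)) =
        ¬□-1 (IsSquare-cancelʳ x≉0 (IsSquare-resp-≈ (trans (enum-neg i) (sym (-1*x≈-x (enum i)))) □-x) □x)

    squares≡1+squares≢1 : count square? ≡ 1 ℕ.+ count square≢1?
    squares≡1+squares≢1 = begin
      count square?                    ≡⟨ count-cong square? (one? ∪? square≢1?) (split , join) ⟩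
      count (one? ∪? square≢1?)        ≡⟨ count-∪ one? square≢1? (λ (x≈1 , (_ , x≉1)) → x≉1 x≈1) ⟩
      count one? ℕ.+ count square≢1?   ≡⟨ cong (ℕ._+ count square≢1?) (count-enum≈ 1#) ⟩
      1 ℕ.+ count square≢1?            ∎
      where
      split : Square ⊆ (λ i → enum i ≈ 1#) ∪ (Square≢1)
      split {i} □x with one? i
      ... | yes x≈1 = inj₁ x≈1
      ... | no x≉1  = inj₂ (□x , x≉1)
      join : (λ i → enum i ≈ 1#) ∪ (Square≢1) ⊆ Square
      join (inj₁ x≈1)     = NonzeroSquare-resp-≈ (sym x≈1) (0≉1 ∘ sym , 1# , *-identityˡ 1#)
      join (inj₂ (□x , _)) = □x

    2∣squares≢1 : 2 ∣ count square≢1?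
    2∣squares≢1 = count-involution square≢1? inv (onIndices-involutive ⁻¹-cong ⁻¹-involutive) preserves moves
      where
      enum-inv : ∀ i → enum (inv i) ≈ enum i ⁻¹
      enum-inv i = enum-index (enum i ⁻¹)
      preserves : ∀ {i} → Square≢1 i → Square≢1 (inv i)
      preserves {i} (□x@(x≉0 , _) , x≉1) = NonzeroSquare-resp-≈ (sym (enum-inv i)) (NonzeroSquare-⁻¹ □x)
                                        , x≉1 ∘ x⁻¹≈1⇒x≈1 x≉0 ∘ trans (sym (enum-inv i))
      moves : ∀ {i} → Square≢1 i → inv i ≢ i
      moves {i} ((x≉0 , □x) , x≉1) inv-i≡i
        with x≈x⁻¹⇒x≈±1 x≉0 (trans (reflexive (cong enum (≡.sym inv-i≡i))) (enum-inv i))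
      ... | inj₁ x≈1  = x≉1 x≈1
      ... | inj₂ x≈-1 = ¬□-1 (IsSquare-resp-≈ x≈-1 □x)

    card%4≡3 : card ℕ.% 4 ≡ 3
    card%4≡3 = from-divides 2∣squares≢1
      where
      from-divides : 2 ∣ count square≢1? → card ℕ.% 4 ≡ 3
      from-divides (divides k squares≢1≡k*2) = ≡.trans (cong (ℕ._% 4) card≡3+k*4) (ℕ.[m+kn]%n≡m%n 3 k 4)
        where
        card≡3+k*4 : card ≡ 3 ℕ.+ k ℕ.* 4
        card≡3+k*4 = begin
          card
            ≡⟨ card≡1+2*squares ⟩
          1 ℕ.+ (count square? ℕ.+ count square?)
            ≡⟨ cong (λ s → 1 ℕ.+ (s ℕ.+ s)) (≡.trans squares≡1+squares≢1 (cong suc squares≢1≡k*2)) ⟩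
          1 ℕ.+ ((1 ℕ.+ k ℕ.* 2) ℕ.+ (1 ℕ.+ k ℕ.* 2))
            ≡⟨ solve 1 (λ k → con 1 :+ ((con 1 :+ k :* con 2) :+ (con 1 :+ k :* con 2)) := con 3 :+ k :* con 4) ≡.refl k ⟩
          3 ℕ.+ k ℕ.* 4 ∎
          where open +-*-Solver

  IsSquare-[-1] : card ℕ.% 4 ≡ 1 → IsSquare F (- 1#)
  IsSquare-[-1] card%4≡1 with isSquare? (- 1#)
  ... | yes □-1 = □-1
  ... | no ¬□-1 = contradiction (≡.trans (≡.sym card%4≡1) card%4≡3) λ ()
    where open WithoutSquareRootOfMinusOne (card%4≡1⇒3<card card%4≡1) ¬□-1

module Diagonal {c ℓ} (F : FiniteField c ℓ) where
  open FiniteField F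
  open FiniteFieldProperties F
  open IntegerRingSolver commutativeRing
  open import Data.Integer using (+_; -[1+_])
  open import Relation.Binary.Reasoning.Setoid setoid

  -- Denotes four F = 1# + 1# + 1# + 1# on the nose, whereas con (+ 4) denotes 4 × 1#.
  ⁴ : ∀ {n} → Polynomial n
  ⁴ = con (+ 1) :+ con (+ 1) :+ con (+ 1) :+ con (+ 1)

  module WithQuarter (quarter : Carrier) (quarter*4≈1 : quarter * four F ≈ 1#) where
    half : Carrier
    half = quarter + quarter

    half*half≈quarter : half * half ≈ quarter
    half*half≈quarter = begin
      (quarter + quarter) * (quarter + quarter)  ≈⟨ solve 1 (λ q → (q :+ q) :* (q :+ q) := q :* (q :* ⁴)) refl quarter ⟩
      quarter * (quarter * four F)               ≈⟨ *-congˡ quarter*4≈1 ⟩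
      quarter * 1#                               ≈⟨ *-identityʳ quarter ⟩
      quarter                                    ∎

    f-diagonal : ∀ a b → f F quarter a a b ≈ b * (a * four F - b) * (half * half)
    f-diagonal a b = begin
      a * a - ((b - a - a) * (b - a - a)) * quarter
        ≈⟨ +-congʳ (trans (sym (*-identityʳ (a * a))) (*-congˡ (sym quarter*4≈1))) ⟩
      a * a * (quarter * four F) - ((b - a - a) * (b - a - a)) * quarter
        ≈⟨ solve 3 (λ a b q → a :* a :* (q :* ⁴) :- ((b :- a :- a) :* (b :- a :- a)) :* q := b :* (a :* ⁴ :- b) :* q)
                   refl a b quarter ⟩
      b * (a * four F - b) * quarter
        ≈⟨ *-congˡ half*half≈quarter ⟨
      b * (a * four F - b) * (half * half) ∎

    f-diagonal-scaledʳ : ∀ t x → f F quarter x x (t * x) ≈ t * (four F - t) * ((x * half) * (x * half))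
    f-diagonal-scaledʳ t x = trans (f-diagonal x (t * x))
      (solve 3 (λ t x h → t :* x :* (x :* ⁴ :- t :* x) :* (h :* h) := t :* (⁴ :- t) :* ((x :* h) :* (x :* h))) refl t x half)

    f-diagonal-scaledˡ : ∀ t x → f F quarter (t * x) (t * x) x ≈ (four F * t - 1#) * ((x * half) * (x * half))
    f-diagonal-scaledˡ t x = trans (f-diagonal (t * x) x)
      (solve 3 (λ t x h → x :* (t :* x :* ⁴ :- x) :* (h :* h) := (⁴ :* t :- con (+ 1)) :* ((x :* h) :* (x :* h))) refl t x half)

    3≉0⇒-6≉0 : fromℤ (+ 3) ≉ 0# → fromℤ -[1+ 5 ] ≉ 0#
    3≉0⇒-6≉0 3≉0 -6≈0 = 3≉0 (begin
      fromℤ (+ 3)                          ≈⟨ *-identityʳ _ ⟨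
      fromℤ (+ 3) * 1#                     ≈⟨ *-congˡ quarter*4≈1 ⟨
      fromℤ (+ 3) * (quarter * four F)     ≈⟨ solve 1 (λ q → con (+ 3) :* (q :* ⁴) := con -[1+ 5 ] :* (:- (q :+ q)))
                                                     refl quarter ⟩
      fromℤ -[1+ 5 ] * - half              ≈⟨ *-congʳ -6≈0 ⟩
      0# * - half                          ≈⟨ zeroˡ _ ⟩
      0#                                   ∎)

    scaled-witness : ∀ t {x} → t ≉ 0# → x ≉ 0# → IsSquare F (t * (four F - t)) → IsSquare F (four F * t - 1#) →
                     ∃ λ j → j ≉ 0# × IsSquare F (f F quarter x x j) × IsSquare F (f F quarter j j x)
    scaled-witness t {x} t≉0 x≉0 □₁ □₂ = t * x
      , *-nonzero t≉0 x≉0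
      , IsSquare-resp-≈ (sym (f-diagonal-scaledʳ t x)) (IsSquare-* □₁ (x * half , refl))
      , IsSquare-resp-≈ (sym (f-diagonal-scaledˡ t x)) (IsSquare-* □₂ (x * half , refl))

lemma8 : ∀ {c ℓ} (F : FiniteField c ℓ) → let open FiniteField F in
    IsPrimePower card → card % 4 ≡ 1 →
    ∀ (quarter : Carrier) → quarter * four F ≈ 1# →
    ∀ (i : Carrier) → ¬ (i ≈ 0#) →
    ∃ λ (j : Carrier) → ¬ (j ≈ 0#) ×
    IsSquare F (f F quarter i i j) × IsSquare F (f F quarter j j i)
lemma8 F _ card%4≡1 quarter quarter*4≈1 i i≉0 = witness
  where
  open FiniteField F
  open FiniteFieldProperties F
  open SquareRootOfMinusOne F
  open Diagonal F
  open WithQuarter quarter quarter*4≈1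
  open IntegerRingSolver commutativeRing
  open import Data.Integer using (+_; -[1+_])
  witness : ∃ λ j → j ≉ 0# × IsSquare F (f F quarter i i j) × IsSquare F (f F quarter j j i)
  witness with isSquare? (fromℤ (+ 3)) | isSquare? (fromℤ -[1+ 4 ])
  ... | yes □3 | _ = scaled-witness 1# (0≉1 ∘ sym) i≉0
      (IsSquare-resp-≈ (solve 0 (con (+ 3) := con (+ 1) :* (⁴ :- con (+ 1))) refl) □3)
      (IsSquare-resp-≈ (solve 0 (con (+ 3) := ⁴ :* con (+ 1) :- con (+ 1)) refl) □3)
  ... | no _ | yes □-5 = scaled-witness (- 1#) (-‿nonzero (0≉1 ∘ sym)) i≉0
      (IsSquare-resp-≈ (solve 0 (con -[1+ 4 ] := (:- con (+ 1)) :* (⁴ :- (:- con (+ 1)))) refl) □-5)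
      (IsSquare-resp-≈ (solve 0 (con -[1+ 4 ] := ⁴ :* (:- con (+ 1)) :- con (+ 1)) refl) □-5)
  ... | no ¬□3 | no ¬□-5 = scaled-witness (fromℤ -[1+ 5 ]) (3≉0⇒-6≉0 (nonsquare⇒nonzero ¬□3)) i≉0
      (IsSquare-resp-≈ (solve 0 (con (+ 3) :* con -[1+ 4 ] :* (con (+ 2) :* con (+ 2)) := con -[1+ 5 ] :* (⁴ :- con -[1+ 5 ])) refl)
        (IsSquare-* (IsSquare-nonsquare*nonsquare (card%4≡1⇒3<card card%4≡1) ¬□3 ¬□-5) (fromℤ (+ 2) , refl)))
      (IsSquare-resp-≈ (solve 0 ((:- con (+ 1)) :* (con (+ 5) :* con (+ 5)) := ⁴ :* con -[1+ 5 ] :- con (+ 1)) refl)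
        (IsSquare-* (IsSquare-[-1] card%4≡1) (fromℤ (+ 5) , refl)))
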